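{- (i) Among all unlabeled binary rooted trees with $n$ leaves, $n\ge1$, the Colijn--Plazzotta rank is maximized by the caterpillar. (ii) Among all unlabeled binary rooted trees with $n$ leaves and height at most $n-2$, $n\ge 4$, the Colijn--Plazzotta rank is maximized by the pseudocaterpillar.
   Context: Trees are unlabeled unordered rooted binary trees, each internal node having exactly two children; height is the number of edges on a longest root-to-leaf path. A caterpillar with $n$ leaves is a tree in which every internal node has at least one leaf child (height $n-1$). The pseudocaterpillar with $n\ge 4$ leaves is obtained from a chain of $n-3$ internal nodes by giving the bottom node two internal children and then adding a layer of external nodes so that the tree has $n$ leaves (height $n-2$). The Colijn--Plazzotta rank $f$: a single leaf has $f=1$; otherwise, with root subtrees $\ell(t),r(t)$ named so that $f(\ell(t))\ge f(r(t))$, $f(t)=f(\ell(t))(f(\ell(t))-1)/2+1+f(r(t))$. -}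

module Defs where

open import Data.Nat using (ℕ; zero; suc; _+_; _*_; _∸_; _⊔_; _⊓_)
open import Data.Nat.DivMod using (_/_)

-- Represented as ordered trees; all quantities below (leaf count, height,
-- Colijn–Plazzotta rank) are invariant under swapping children, so they
-- are well defined on the unordered (unlabeled) trees of the paper.
data Tree : Set where
  leaf : Tree
  node : Tree → Tree → Tree

leaves : Tree → ℕ
leaves leaf       = 1
leaves (node l r) = leaves l + leaves r

height : Tree → ℕ
height leaf       = 0
height (node l r) = suc (height l ⊔ height r)

cpRank : Tree → ℕ
cpRank leaf       = 1
cpRank (node l r) =
  ((cpRank l ⊔ cpRank r) * ((cpRank l ⊔ cpRank r) ∸ 1)) / 2 + 1 + (cpRank l ⊓ cpRank r)

-- caterpillar with n leaves (n ≥ 1); value at n = 0 is an unused dummy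
caterpillar : ℕ → Tree
caterpillar zero          = leaf
caterpillar (suc zero)    = leaf
caterpillar (suc (suc n)) = node (caterpillar (suc n)) leaf

-- pseudocaterpillar with n leaves (n ≥ 4): a chain of n-3 internal nodes,
-- each but the bottom one having a leaf child, the bottom one having two
-- cherries as children; values for n < 4 are unused dummies
cherry : Tree
cherry = node leaf leaf

pseudocaterpillar : ℕ → Tree
pseudocaterpillar (suc (suc (suc (suc (suc n))))) =
  node (pseudocaterpillar (suc (suc (suc (suc n))))) leaf
pseudocaterpillar _ = node cherry cherry

{-# OPTIONS --safe #-}

-- The rank of a node is monotone in the ranks of its children.  Grafting a
-- leaf onto a tree of rank x ≥ 1 gives rank C(x,2) + 2, whereas a node whose
-- children both have rank below x has rank at most C(x,2) + 1.  So a tree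
-- whose children both carry at least two of its n leaves is outranked by the
-- node joining two caterpillars on n − 2 leaves, hence by the caterpillar on n
-- leaves (a leaf grafted onto the one on n − 1 leaves).  Under the height
-- bound the same comparison works with the pseudocaterpillar, whose rank
-- already exceeds that of the caterpillar with one leaf fewer.
module Submission where

open import Defs
open import Data.Nat using (ℕ; zero; suc; _+_; _*_; _∸_; _^_; _⊔_; _⊓_; _≤_; _<_; _≤′_; ≤′-refl; ≤′-step; s≤s; z≤n)
open import Data.Nat.Properties
open import Data.Nat.DivMod using (_/_; +-distrib-/-∣ʳ; m*n/n≡m; /-monoˡ-≤)
open import Data.Nat.Divisibility using (divides)
open import Data.Nat.Solver using (module +-*-Solver)
open import Data.Product using (_×_; _,_)
open import Data.Empty using (⊥-elim)
open import Relation.Binary.PropositionalEquality using (_≡_; refl; sym; trans; cong; cong₂; subst; module ≡-Reasoning)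

choose2 : ℕ → ℕ
choose2 x = (x * (x ∸ 1)) / 2

choose2-suc : ∀ x → choose2 (suc x) ≡ choose2 x + x
choose2-suc zero    = refl
choose2-suc (suc y) = begin
  (suc (suc y) * suc y) / 2          ≡⟨ cong (_/ 2) (square-split y) ⟩
  (suc y * y + suc y * 2) / 2        ≡⟨ +-distrib-/-∣ʳ (suc y * y) (divides (suc y) refl) ⟩
  (suc y * y) / 2 + (suc y * 2) / 2  ≡⟨ cong ((suc y * y) / 2 +_) (m*n/n≡m (suc y) 2) ⟩
  (suc y * y) / 2 + suc y            ∎
  where
  open ≡-Reasoning
  open +-*-Solver
  square-split : ∀ y → suc (suc y) * suc y ≡ suc y * y + suc y * 2
  square-split = solve 1 (λ y → (con 2 :+ y) :* (con 1 :+ y) := (con 1 :+ y) :* y :+ (con 1 :+ y) :* con 2) refl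

choose2-mono-≤ : ∀ {x y} → x ≤ y → choose2 x ≤ choose2 y
choose2-mono-≤ x≤y = /-monoˡ-≤ 2 (*-mono-≤ x≤y (∸-monoˡ-≤ 1 x≤y))

choose2-mono-< : ∀ {x y} → 1 ≤ x → x < y → choose2 x < choose2 y
choose2-mono-< {x} 1≤x x<y = begin-strict
  choose2 x       <⟨ m<m+n (choose2 x) 1≤x ⟩
  choose2 x + x   ≡⟨ sym (choose2-suc x) ⟩
  choose2 (suc x) ≤⟨ choose2-mono-≤ x<y ⟩
  _               ∎
  where open ≤-Reasoning

cpNode : ℕ → ℕ → ℕ
cpNode a b = choose2 (a ⊔ b) + 1 + (a ⊓ b)

cpNode-comm : ∀ a b → cpNode a b ≡ cpNode b a
cpNode-comm a b rewrite ⊔-comm a b | ⊓-comm a b = refl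

cpNode-mono-≤ : ∀ {a a′ b b′} → a ≤ a′ → b ≤ b′ → cpNode a b ≤ cpNode a′ b′
cpNode-mono-≤ a≤a′ b≤b′ =
  +-mono-≤ (+-monoˡ-≤ 1 (choose2-mono-≤ (⊔-mono-≤ a≤a′ b≤b′))) (⊓-mono-≤ a≤a′ b≤b′)

cpNode-leaf : ∀ {x} → 1 ≤ x → cpNode x 1 ≡ choose2 x + 1 + 1
cpNode-leaf 1≤x rewrite m≥n⇒m⊔n≡m 1≤x | m≥n⇒m⊓n≡n 1≤x = refl

cpNode-diag : ∀ x → cpNode x x ≡ choose2 (suc x) + 1
cpNode-diag x = begin
  choose2 (x ⊔ x) + 1 + (x ⊓ x) ≡⟨ cong₂ (λ u v → choose2 u + 1 + v) (⊔-idem x) (⊓-idem x) ⟩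
  choose2 x + 1 + x             ≡⟨ +-assoc (choose2 x) 1 x ⟩
  choose2 x + suc x             ≡⟨ +-suc (choose2 x) x ⟩
  suc (choose2 x + x)           ≡⟨ cong suc (sym (choose2-suc x)) ⟩
  suc (choose2 (suc x))         ≡⟨ +-comm 1 (choose2 (suc x)) ⟩
  choose2 (suc x) + 1           ∎
  where open ≡-Reasoning

x<cpNode-x-1 : ∀ {x} → 1 ≤ x → x < cpNode x 1
x<cpNode-x-1 {suc k} 1≤x = begin-strict
  suc k                        ≡⟨ +-comm 1 k ⟩
  k + 1                        ≤⟨ +-monoˡ-≤ 1 (m≤n+m k (choose2 k)) ⟩
  choose2 k + k + 1            ≡⟨ cong (_+ 1) (sym (choose2-suc k)) ⟩
  choose2 (suc k) + 1          <⟨ m<m+n (choose2 (suc k) + 1) (s≤s z≤n) ⟩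
  choose2 (suc k) + 1 + 1      ≡⟨ sym (cpNode-leaf 1≤x) ⟩
  cpNode (suc k) 1             ∎
  where open ≤-Reasoning

cpNode-leaf-mono-< : ∀ {x y} → 1 ≤ x → x < y → cpNode x 1 < cpNode y 1
cpNode-leaf-mono-< {x} {y} 1≤x x<y = begin-strict
  cpNode x 1              ≡⟨ cpNode-leaf 1≤x ⟩
  choose2 x + 1 + 1       <⟨ +-monoˡ-< 1 (+-monoˡ-< 1 (choose2-mono-< 1≤x x<y)) ⟩
  choose2 y + 1 + 1       ≡⟨ sym (cpNode-leaf (≤-trans 1≤x (<⇒≤ x<y))) ⟩
  cpNode y 1              ∎
  where open ≤-Reasoning

cpNode-diag<cpNode-leaf : ∀ {x y} → x < y → cpNode x x < cpNode y 1
cpNode-diag<cpNode-leaf {x} {y} x<y = begin-strict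
  cpNode x x              ≡⟨ cpNode-diag x ⟩
  choose2 (suc x) + 1     ≤⟨ +-monoˡ-≤ 1 (choose2-mono-≤ x<y) ⟩
  choose2 y + 1           <⟨ m<m+n (choose2 y + 1) (s≤s z≤n) ⟩
  choose2 y + 1 + 1       ≡⟨ sym (cpNode-leaf (≤-trans (s≤s z≤n) x<y)) ⟩
  cpNode y 1              ∎
  where open ≤-Reasoning

1≤cpRank : ∀ t → 1 ≤ cpRank t
1≤cpRank leaf       = ≤-refl
1≤cpRank (node l r) = ≤-trans (m≤n+m 1 (choose2 (cpRank l ⊔ cpRank r))) (m≤m+n _ _)

1≤leaves : ∀ t → 1 ≤ leaves t
1≤leaves leaf       = ≤-refl
1≤leaves (node l r) = ≤-trans (1≤leaves l) (m≤m+n (leaves l) (leaves r))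

2≤leaves-node : ∀ l r → 2 ≤ leaves (node l r)
2≤leaves-node l r = +-mono-≤ (1≤leaves l) (1≤leaves r)

leaves-graft : ∀ t → leaves (node t leaf) ≡ suc (leaves t)
leaves-graft t = +-comm (leaves t) 1

height-graft : ∀ t → height (node t leaf) ≡ suc (height t)
height-graft t = cong suc (⊔-identityʳ (height t))

leaves≤2^height : ∀ t → leaves t ≤ 2 ^ height t
leaves≤2^height leaf       = ≤-refl
leaves≤2^height (node l r) = begin
  leaves l + leaves r  ≤⟨ +-mono-≤ (bound l (m≤m⊔n (height l) (height r)))
                                   (bound r (m≤n⊔m (height l) (height r))) ⟩
  2 ^ h + 2 ^ h        ≡⟨ cong (2 ^ h +_) (sym (+-identityʳ (2 ^ h))) ⟩
  2 ^ suc h            ∎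
  where
  open ≤-Reasoning
  h = height l ⊔ height r
  bound : ∀ t → height t ≤ h → leaves t ≤ 2 ^ h
  bound t ht≤h = ≤-trans (leaves≤2^height t) (^-monoʳ-≤ 2 ht≤h)

catRank : ℕ → ℕ
catRank n = cpRank (caterpillar n)

pseudoRank : ℕ → ℕ
pseudoRank n = cpRank (pseudocaterpillar n)

catRank-mono-≤ : ∀ {m n} → m ≤ n → catRank m ≤ catRank n
catRank-mono-≤ m≤n = mono′ (≤⇒≤′ m≤n)
  where
  step : ∀ n → catRank n ≤ catRank (suc n)
  step zero    = ≤-refl
  step (suc n) = <⇒≤ (x<cpNode-x-1 (1≤cpRank (caterpillar (suc n))))
  mono′ : ∀ {m n} → m ≤′ n → catRank m ≤ catRank n
  mono′ ≤′-refl        = ≤-refl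
  mono′ (≤′-step {n} m≤′n) = ≤-trans (mono′ m≤′n) (step n)

catRank-graft : ∀ {n x} → 1 ≤ n → x ≤ catRank n → cpNode x 1 ≤ catRank (suc n)
catRank-graft {suc n} _ x≤c = cpNode-mono-≤ x≤c ≤-refl

catRank-pair-≤-diag : ∀ p q →
  cpNode (catRank (2 + p)) (catRank (2 + q)) ≤ cpNode (catRank (2 + (p + q))) (catRank (2 + (p + q)))
catRank-pair-≤-diag p q =
  cpNode-mono-≤ (catRank-mono-≤ (s≤s (s≤s (m≤m+n p q)))) (catRank-mono-≤ (s≤s (s≤s (m≤n+m q p))))

2+p+2+q≡4+[p+q] : ∀ p q → (2 + p) + (2 + q) ≡ 4 + (p + q)
2+p+2+q≡4+[p+q] p q = cong (2 +_) (trans (+-suc p (suc q)) (cong suc (+-suc p q)))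

catRank-pair : ∀ {x y} → 2 ≤ x → 2 ≤ y → cpNode (catRank x) (catRank y) ≤ catRank (x + y)
catRank-pair {suc (suc p)} {suc (suc q)} (s≤s (s≤s _)) (s≤s (s≤s _)) = begin
  cpNode (catRank (2 + p)) (catRank (2 + q))  ≤⟨ catRank-pair-≤-diag p q ⟩
  cpNode (catRank m) (catRank m)              ≤⟨ <⇒≤ (cpNode-diag<cpNode-leaf (x<cpNode-x-1 (1≤cpRank (caterpillar m)))) ⟩
  catRank (4 + (p + q))                       ≡⟨ cong catRank (sym (2+p+2+q≡4+[p+q] p q)) ⟩
  catRank ((2 + p) + (2 + q))                 ∎
  where
  open ≤-Reasoning
  m = 2 + (p + q)

catRank<pseudoRank : ∀ j → catRank (3 + j) < pseudoRank (4 + j)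
catRank<pseudoRank zero    = ≤-refl
catRank<pseudoRank (suc j) =
  cpNode-leaf-mono-< (1≤cpRank (caterpillar (3 + j))) (catRank<pseudoRank j)

catRank-diag≤pseudoRank : ∀ j → cpNode (catRank (2 + j)) (catRank (2 + j)) ≤ pseudoRank (4 + j)
catRank-diag≤pseudoRank zero    = ≤-refl
catRank-diag≤pseudoRank (suc j) = <⇒≤ (cpNode-diag<cpNode-leaf (catRank<pseudoRank j))

pseudoRank-pair : ∀ {x y} → 2 ≤ x → 2 ≤ y → cpNode (catRank x) (catRank y) ≤ pseudoRank (x + y)
pseudoRank-pair {suc (suc p)} {suc (suc q)} (s≤s (s≤s _)) (s≤s (s≤s _)) = begin
  cpNode (catRank (2 + p)) (catRank (2 + q))  ≤⟨ catRank-pair-≤-diag p q ⟩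
  cpNode (catRank m) (catRank m)              ≤⟨ catRank-diag≤pseudoRank (p + q) ⟩
  pseudoRank (4 + (p + q))                    ≡⟨ cong pseudoRank (sym (2+p+2+q≡4+[p+q] p q)) ⟩
  pseudoRank ((2 + p) + (2 + q))              ∎
  where
  open ≤-Reasoning
  m = 2 + (p + q)

cpRank≤catRank : ∀ t → cpRank t ≤ catRank (leaves t)
cpRank≤catRank leaf = ≤-refl
cpRank≤catRank (node l leaf) =
  subst (λ n → cpRank (node l leaf) ≤ catRank n) (sym (leaves-graft l))
    (catRank-graft (1≤leaves l) (cpRank≤catRank l))
cpRank≤catRank (node leaf r) =
  subst (_≤ catRank (suc (leaves r))) (cpNode-comm (cpRank r) 1)
    (catRank-graft (1≤leaves r) (cpRank≤catRank r))
cpRank≤catRank (node l@(node a b) r@(node c d)) =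
  ≤-trans (cpNode-mono-≤ (cpRank≤catRank l) (cpRank≤catRank r))
          (catRank-pair (2≤leaves-node a b) (2≤leaves-node c d))

PseudoBound : Tree → ℕ → Set
PseudoBound t j = leaves t ≡ 4 + j → height t ≤ 2 + j → cpRank t ≤ pseudoRank (4 + j)

-- The case j = 0 is vacuous: a tree with three leaves has height 2.
pseudoRank-graft : ∀ t {j} → leaves t ≡ 3 + j → height t ≤ 1 + j →
  (∀ i → PseudoBound t i) → cpNode (cpRank t) 1 ≤ pseudoRank (4 + j)
pseudoRank-graft t {zero} three ht≤1 _ =
  ⊥-elim (<-irrefl {2} refl (subst (_≤ 2) three (≤-trans (leaves≤2^height t) (^-monoʳ-≤ 2 ht≤1))))
pseudoRank-graft t {suc j} e h bound = cpNode-mono-≤ (bound j e h) ≤-refl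

cpRank≤pseudoRank : ∀ t j → PseudoBound t j
cpRank≤pseudoRank leaf _ ()
cpRank≤pseudoRank (node l leaf) j e h =
  pseudoRank-graft l (suc-injective (trans (sym (leaves-graft l)) e))
    (≤-pred (subst (_≤ 2 + j) (height-graft l) h)) (cpRank≤pseudoRank l)
cpRank≤pseudoRank (node leaf r) j e h =
  subst (_≤ pseudoRank (4 + j)) (cpNode-comm (cpRank r) 1)
    (pseudoRank-graft r (suc-injective e) (≤-pred h) (cpRank≤pseudoRank r))
cpRank≤pseudoRank (node l@(node a b) r@(node c d)) j e _ =
  subst (λ n → cpRank (node l r) ≤ pseudoRank n) e
    (≤-trans (cpNode-mono-≤ (cpRank≤catRank l) (cpRank≤catRank r))
             (pseudoRank-pair (2≤leaves-node a b) (2≤leaves-node c d)))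

leaves-caterpillar : ∀ {n} → 1 ≤ n → leaves (caterpillar n) ≡ n
leaves-caterpillar {suc zero}    _ = refl
leaves-caterpillar {suc (suc n)} _ =
  trans (leaves-graft (caterpillar (suc n))) (cong suc (leaves-caterpillar (s≤s z≤n)))

leaves-pseudocaterpillar : ∀ j → leaves (pseudocaterpillar (4 + j)) ≡ 4 + j
leaves-pseudocaterpillar zero    = refl
leaves-pseudocaterpillar (suc j) =
  trans (leaves-graft (pseudocaterpillar (4 + j))) (cong suc (leaves-pseudocaterpillar j))

height-pseudocaterpillar : ∀ j → height (pseudocaterpillar (4 + j)) ≡ 2 + j
height-pseudocaterpillar zero    = refl
height-pseudocaterpillar (suc j) =
  trans (height-graft (pseudocaterpillar (4 + j))) (cong suc (height-pseudocaterpillar j))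

lemma2 :
    ((n : ℕ) → 1 ≤ n →
      leaves (caterpillar n) ≡ n ×
      ((t : Tree) → leaves t ≡ n → cpRank t ≤ cpRank (caterpillar n)))
    ×
    ((n : ℕ) → 4 ≤ n →
      (leaves (pseudocaterpillar n) ≡ n × height (pseudocaterpillar n) ≤ n ∸ 2) ×
      ((t : Tree) → leaves t ≡ n → height t ≤ n ∸ 2 →
        cpRank t ≤ cpRank (pseudocaterpillar n)))
lemma2 = caterpillar-maximal , pseudocaterpillar-maximal
  where
  caterpillar-maximal : (n : ℕ) → 1 ≤ n →
    leaves (caterpillar n) ≡ n × ((t : Tree) → leaves t ≡ n → cpRank t ≤ catRank n)
  caterpillar-maximal n 1≤n =
    leaves-caterpillar 1≤n , λ t e → subst (λ m → cpRank t ≤ catRank m) e (cpRank≤catRank t)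
  pseudocaterpillar-maximal : (n : ℕ) → 4 ≤ n →
    (leaves (pseudocaterpillar n) ≡ n × height (pseudocaterpillar n) ≤ n ∸ 2) ×
    ((t : Tree) → leaves t ≡ n → height t ≤ n ∸ 2 → cpRank t ≤ pseudoRank n)
  pseudocaterpillar-maximal _ (s≤s (s≤s (s≤s (s≤s {n = j} _)))) =
    (leaves-pseudocaterpillar j , ≤-reflexive (height-pseudocaterpillar j)) ,
    λ t → cpRank≤pseudoRank t j
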